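{- Let $m,n\geq 3$. The direct product $C_m\times C_n$ is distance magic if and only if $n=4$ or $m=4$ or $m,n\equiv 0\pmod 4$. Moreover, $C_m\times C_n$ is balanced distance magic if and only if $n=4$ or $m=4$.
   Context: $C_n$ denotes the cycle on $n$ vertices. The direct product $G\times H$ has vertex set $V(G)\times V(H)$, with $(g,h)$ adjacent to $(g',h')$ iff $gg'\in E(G)$ and $hh'\in E(H)$. $N(x)$ is the open neighborhood of $x$. A graph $X$ of order $N$ is distance magic if there is a bijection $\ell\colon V(X)\to\{1,\ldots,N\}$ and a positive integer $k$ such that $\sum_{y\in N(x)}\ell(y)=k$ for every vertex $x$. A distance magic graph $X$ with an even number of vertices is balanced distance magic if there exists a bijection $\ell\colon V(X)\to\{1,\ldots,|V(X)|\}$ such that for every $w\in V(X)$: whenever $u\in N(w)$ has $\ell(u)=i$, there exists $v\in N(w)$ with $\ell(v)=|V(X)|+1-i$. -}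

module Defs where

open import Data.Nat using (ℕ; suc; _+_; _*_; _∸_)
open import Data.Nat.DivMod using (_%_)
open import Data.Fin using (Fin; toℕ; combine; remQuot)
open import Data.Bool using (Bool; true; false; if_then_else_; _∨_; _∧_)
open import Data.List using (List; map; allFin)
open import Data.Nat.ListAction using (sum)
open import Data.Product using (Σ; ∃; _×_; _,_; proj₁; proj₂)
open import Function.Bundles using (_↔_)
open import Relation.Binary.PropositionalEquality using (_≡_)
open import Relation.Nullary using (does)
open import Data.Nat using (_≟_)

record Graph : Set where
  field
    order : ℕ
    adj   : Fin order → Fin order → Bool

open Graph public

-- Cycle C_m on vertices 0..m-1: i ~ j iff j ≡ i+1 (mod m) or i ≡ j+1 (mod m).
-- For m ≥ 3 this is the usual cycle.
cycAdj : (m : ℕ) → Fin m → Fin m → Bool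
cycAdj m i j = does ((suc (toℕ i) % suc (m ∸ 1)) ≟ toℕ j)
             ∨ does ((suc (toℕ j) % suc (m ∸ 1)) ≟ toℕ i)

Cycle : ℕ → Graph
Cycle m = record { order = m ; adj = cycAdj m }

-- Direct (tensor / categorical) product G × H; the vertex (g , h) is encoded
-- as combine g h : Fin (|G| * |H|).
_×ᵍ_ : Graph → Graph → Graph
G ×ᵍ H = record
  { order = order G * order H
  ; adj   = λ x y →
      let (g , h)   = remQuot {order G} (order H) x
          (g' , h') = remQuot {order G} (order H) y
      in adj G g g' ∧ adj H h h' }

-- Labeling: a bijection V(X) ≅ Fin N, with label ℓ(x) = 1 + toℕ (f x) ∈ {1..N}.
Labeling : Graph → Set
Labeling X = Fin (order X) ↔ Fin (order X)

label : (X : Graph) → Labeling X → Fin (order X) → ℕ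
label X f x = suc (toℕ (Function.Bundles.Inverse.to f x))

weight : (X : Graph) → Labeling X → Fin (order X) → ℕ
weight X f x = sum (map (λ y → if adj X x y then label X f y else 0) (allFin (order X)))

IsDistanceMagic : Graph → Set
IsDistanceMagic X = Σ (Labeling X) λ f → Σ ℕ λ k →
  (1 Data.Nat.≤ k) × ((x : Fin (order X)) → weight X f x ≡ k)

IsBalancedLabeling : (X : Graph) → Labeling X → Set
IsBalancedLabeling X f = (w u : Fin (order X)) → adj X w u ≡ true →
  Σ (Fin (order X)) λ v → (adj X w v ≡ true) ×
    (label X f v ≡ (order X + 1) ∸ label X f u)

Even : ℕ → Set
Even N = Σ ℕ λ t → N ≡ t + t

IsBalancedDistanceMagic : Graph → Set
IsBalancedDistanceMagic X =
  IsDistanceMagic X × Even (order X) × Σ (Labeling X) (IsBalancedLabeling X)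

module Submission where

open import Defs
open import Data.Nat using (ℕ; _≥_; _%_)
open import Data.Product using (_×_)
open import Data.Sum using (_⊎_)
open import Function.Bundles using (_⇔_)
open import Relation.Binary.PropositionalEquality using (_≡_)

open import Data.Bool using (Bool; true; false; if_then_else_; _∨_; _∧_; not; _xor_)
open import Data.Bool.Properties using (∨-comm; ∧-comm)
open import Data.Empty using (⊥; ⊥-elim)
open import Data.Fin using (Fin; zero; suc; toℕ; fromℕ<; combine; remQuot; _↑ˡ_; _↑ʳ_; punchIn; punchOut; opposite; splitAt; cast)
open import Data.Fin.Permutation using (Permutation; permutation; _⟨$⟩ʳ_; _⟨$⟩ˡ_; _∘ₚ_; cast-id; ↔⇒≡; inverseˡ; inverseʳ)
open import Data.Fin.Properties using (toℕ-injective; toℕ-fromℕ<; toℕ<n; toℕ-cast; toℕ-combine; toℕ-↑ʳ; toℕ-↑ˡ; remQuot-combine; combine-remQuot; combine-injectiveˡ; combine-injectiveʳ; *↔×; ↑ʳ-injective; ↑ˡ-injective; splitAt-↑ʳ; splitAt-↑ˡ; opposite-prop; opposite-involutive; punchInᵢ≢i; punchOut-injective; pigeonhole; any?) renaming (_≟_ to _≟ᶠ_; <⇒≢ to <⇒≢ᶠ)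
open import Data.List using (map; allFin; tabulate; []; _∷_)
open import Data.List.Properties using (map-tabulate)
open import Data.Nat using (zero; suc; _+_; _*_; _∸_; _≤_; _<_; z≤n; s≤s; s≤s⁻¹; _/_; _≟_; ⌊_/2⌋)
open import Data.Nat.DivMod using (m%n<n; m<n⇒m%n≡m; %-distribˡ-+; m%n%n≡m%n; [m+kn]%n≡m%n; m≡m%n+[m/n]*n)
open import Data.Nat.ListAction using () renaming (sum to sumᴸ)
open import Data.Nat.Properties using (+-0-commutativeMonoid; +-commutativeSemigroup; +-assoc; +-comm; +-identityʳ; +-suc; +-cancelˡ-≡; +-cancelʳ-≡; *-assoc; *-comm; *-identityˡ; *-suc; suc-injective; ≤-trans; m≤m+n; n<1+n; m+[n∸m]≡n; m+n∸m≡n; n≡⌊n+n/2⌋; even≢odd)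
open import Data.Nat.Tactic.RingSolver using (solve-∀; solve)
open import Algebra.Properties.CommutativeMonoid.Sum +-0-commutativeMonoid
  using (sum; sum-syntax; sum-cong-≗; sum-remove; sum-replicate-zero; ∑-distrib-+; ∑-permute)
open import Algebra.Properties.CommutativeSemigroup +-commutativeSemigroup using (interchange)
open import Data.Product using (Σ; ∃₂; _,_; proj₁; proj₂)
open import Data.Product.Algebra using (×-comm)
open import Data.Sum using (inj₁; inj₂; [_,_])
open import Function using (_∘_; id)
open import Function.Bundles using (mk⇔; Equivalence)
open import Function.Properties.Inverse using (↔-trans; ↔-sym)
open import Relation.Binary.PropositionalEquality using (refl; sym; trans; cong; cong₂; subst; subst₂; _≢_; module ≡-Reasoning)
open import Relation.Nullary using (Dec; does; yes; no)
open import Relation.Nullary.Decidable using (dec-true; dec-false)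

-- Write M = 3 + a and K = 3 + b. On C_M the neighbours of i are `next i` and `prev i` (rotations
-- by ±1), so the neighbourhood of (i , j) in C_M × C_K is the square (i ± 1 , j ± 1) and its
-- weight is the sum of four labels (`weight-square`). Both properties are invariant under graph
-- isomorphism and C_M × C_K ≅ C_K × C_M (`×ᵍ-comm`), so each asymmetric step is proved once.
--   * Distance magic and 4 ∤ K force M = 4 (`distance-magic⇒length-4`): the sums
--     T(i , j) = ℓ(i + 1 , j) + ℓ(i - 1 , j) satisfy T(i , j + 1) + T(i , j - 1) = k, which on a
--     cycle of length not divisible by 4 forces 2T = k; then T(0 , 0) = T(2 , 0) gives -1 ≡ 3.
--   * A balanced labeling forces M = 4 or K = 4 (`no-balanced-labeling`): (1 , 1) and
--     (-1 , -1) have (0 , 0) as their only common neighbour, whose label would be self-complementary.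
--   * Conversely C_4 × C_K has a balanced labeling pairing antipodal vertices (`FourByK`), and
--     C_{4P} × C_{4Q} has a distance magic labeling built from pairs {i , i + 2} (`MultiplesOf4`).

sumᴸ-allFin : ∀ n (h : Fin n → ℕ) → sumᴸ (map h (allFin n)) ≡ ∑[ i < n ] h i
sumᴸ-allFin n h = trans (cong sumᴸ (map-tabulate id h)) (sumᴸ-tabulate n h)
  where
  sumᴸ-tabulate : ∀ n (h : Fin n → ℕ) → sumᴸ (tabulate h) ≡ ∑[ i < n ] h i
  sumᴸ-tabulate zero    h = refl
  sumᴸ-tabulate (suc n) h = cong (h zero +_) (sumᴸ-tabulate n (h ∘ suc))

∑-split : ∀ m n (h : Fin (m + n) → ℕ) →
  ∑[ x < m + n ] h x ≡ ∑[ i < m ] h (i ↑ˡ n) + ∑[ j < n ] h (m ↑ʳ j)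
∑-split zero    n h = refl
∑-split (suc m) n h = trans (cong (h zero +_) (∑-split m n (h ∘ suc))) (sym (+-assoc (h zero) _ _))

∑-combine : ∀ m n (h : Fin (m * n) → ℕ) →
  ∑[ x < m * n ] h x ≡ ∑[ i < m ] ∑[ j < n ] h (combine i j)
∑-combine zero    n h = refl
∑-combine (suc m) n h =
  trans (∑-split n (m * n) h) (cong (∑[ j < n ] h (j ↑ˡ (m * n)) +_) (∑-combine m n (h ∘ (n ↑ʳ_))))

∑-point : ∀ n (h : Fin n → ℕ) (a : Fin n) → (∀ j → j ≢ a → h j ≡ 0) → ∑[ j < n ] h j ≡ h a
∑-point (suc n) h a vanish = begin
  sum h                                ≡⟨ sum-remove {i = a} h ⟩
  h a + ∑[ j < n ] h (punchIn a j)     ≡⟨ cong (h a +_) (sum-cong-≗ λ j → vanish _ (punchInᵢ≢i a j)) ⟩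
  h a + ∑[ j < n ] 0                   ≡⟨ cong (h a +_) (sum-replicate-zero n) ⟩
  h a + 0                              ≡⟨ +-identityʳ (h a) ⟩
  h a                                  ∎
  where open ≡-Reasoning

∑-two-points : ∀ n (P : Fin n → Bool) (g : Fin n → ℕ) (a b : Fin n) → a ≢ b →
  P a ≡ true → P b ≡ true → (∀ j → P j ≡ true → j ≡ a ⊎ j ≡ b) →
  ∑[ j < n ] (if P j then g j else 0) ≡ g a + g b
∑-two-points n P g a b a≢b Pa Pb onlyAB = begin
  ∑[ j < n ] (if P j then g j else 0) ≡⟨ sum-cong-≗ split ⟩
  ∑[ j < n ] (at a j + at b j)        ≡⟨ ∑-distrib-+ (at a) (at b) ⟩
  sum (at a) + sum (at b)             ≡⟨ cong₂ _+_ (∑-point n (at a) a (at-off a)) (∑-point n (at b) b (at-off b)) ⟩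
  at a a + at b b                     ≡⟨ cong₂ _+_ (at-on a) (at-on b) ⟩
  g a + g b                           ∎
  where
  open ≡-Reasoning
  at : Fin n → Fin n → ℕ
  at c j = if does (j ≟ᶠ c) then g j else 0
  at-off : ∀ c j → j ≢ c → at c j ≡ 0
  at-off c j j≢c rewrite dec-false (j ≟ᶠ c) j≢c = refl
  at-on : ∀ c → at c c ≡ g c
  at-on c rewrite dec-true (c ≟ᶠ c) refl = refl
  split : ∀ j → (if P j then g j else 0) ≡ at a j + at b j
  split j with j ≟ᶠ a | j ≟ᶠ b
  ... | yes refl | yes refl = ⊥-elim (a≢b refl)
  ... | yes refl | no _    rewrite Pa = sym (+-identityʳ (g a))
  ... | no _     | yes refl rewrite Pb = refl
  ... | no j≢a   | no j≢b with P j in Pj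
  ...   | false = refl
  ...   | true  = [ (λ j≡a → ⊥-elim (j≢a j≡a)) , (λ j≡b → ⊥-elim (j≢b j≡b)) ] (onlyAB j Pj)

rot : ∀ {n} → ℕ → Fin (suc n) → Fin (suc n)
rot {n} t i = fromℕ< (m%n<n (t + toℕ i) (suc n))

toℕ-rot : ∀ {n} t (i : Fin (suc n)) → toℕ (rot t i) ≡ (t + toℕ i) % suc n
toℕ-rot {n} t i = toℕ-fromℕ< (m%n<n (t + toℕ i) (suc n))

[m+n%d]%d≡[m+n]%d : ∀ m n d → (m + n % suc d) % suc d ≡ (m + n) % suc d
[m+n%d]%d≡[m+n]%d m n d = begin
  (m + n % suc d) % suc d                  ≡⟨ %-distribˡ-+ m (n % suc d) (suc d) ⟩
  (m % suc d + n % suc d % suc d) % suc d  ≡⟨ cong (λ x → (m % suc d + x) % suc d) (m%n%n≡m%n n (suc d)) ⟩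
  (m % suc d + n % suc d) % suc d          ≡⟨ %-distribˡ-+ m n (suc d) ⟨
  (m + n) % suc d                          ∎
  where open ≡-Reasoning

rot-rot : ∀ {n} s t (i : Fin (suc n)) → rot s (rot t i) ≡ rot (s + t) i
rot-rot {n} s t i = toℕ-injective (begin
  toℕ (rot s (rot t i))            ≡⟨ toℕ-rot s (rot t i) ⟩
  (s + toℕ (rot t i)) % suc n      ≡⟨ cong (λ x → (s + x) % suc n) (toℕ-rot t i) ⟩
  (s + (t + toℕ i) % suc n) % suc n ≡⟨ [m+n%d]%d≡[m+n]%d s (t + toℕ i) n ⟩
  (s + (t + toℕ i)) % suc n        ≡⟨ cong (_% suc n) (+-assoc s t (toℕ i)) ⟨
  (s + t + toℕ i) % suc n          ≡⟨ toℕ-rot (s + t) i ⟨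
  toℕ (rot (s + t) i)              ∎)
  where open ≡-Reasoning

rot-period : ∀ {n} c (i : Fin (suc n)) → rot (c * suc n) i ≡ i
rot-period {n} c i = toℕ-injective (begin
  toℕ (rot (c * suc n) i)        ≡⟨ toℕ-rot (c * suc n) i ⟩
  (c * suc n + toℕ i) % suc n    ≡⟨ cong (_% suc n) (+-comm (c * suc n) (toℕ i)) ⟩
  (toℕ i + c * suc n) % suc n    ≡⟨ [m+kn]%n≡m%n (toℕ i) c (suc n) ⟩
  toℕ i % suc n                  ≡⟨ m<n⇒m%n≡m (toℕ<n i) ⟩
  toℕ i                          ∎)
  where open ≡-Reasoning

next prev : ∀ {n} → Fin (suc n) → Fin (suc n)
next = rot 1
prev {n} = rot n

rot-length : ∀ {n} (i : Fin (suc n)) → rot (suc n) i ≡ i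
rot-length {n} i = subst (λ t → rot t i ≡ i) (*-identityˡ (suc n)) (rot-period 1 i)

next-prev : ∀ {n} (i : Fin (suc n)) → next (prev i) ≡ i
next-prev {n} i = trans (rot-rot 1 n i) (rot-length i)

prev-next : ∀ {n} (i : Fin (suc n)) → prev (next i) ≡ i
prev-next {n} i = trans (rot-rot n 1 i) (subst (λ t → rot t i ≡ i) (+-comm 1 n) (rot-length i))

rot-2-moves : ∀ {a} (i : Fin (3 + a)) → rot 2 i ≢ i
rot-2-moves {a} i fixed = two≢multiple q (+-cancelˡ-≡ x 2 (q * M) (trans (+-comm x 2) decomposition))
  where
  x = toℕ i
  M = 3 + a
  q = (2 + x) / M
  decomposition : 2 + x ≡ x + q * M
  decomposition = trans (m≡m%n+[m/n]*n (2 + x) M) (cong (_+ q * M) (trans (sym (toℕ-rot 2 i)) (cong toℕ fixed)))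
  two≢multiple : ∀ q → 2 ≢ q * M
  two≢multiple zero    ()
  two≢multiple (suc q) ()

next≢prev : ∀ {a} (i : Fin (3 + a)) → next i ≢ prev i
next≢prev i next≡prev = rot-2-moves i (begin
  rot 2 i          ≡⟨ rot-rot 1 1 i ⟨
  next (next i)    ≡⟨ cong next next≡prev ⟩
  next (prev i)    ≡⟨ next-prev i ⟩
  i                ∎)
  where open ≡-Reasoning

decided : ∀ {A : Set} (d : Dec A) → does d ≡ true → A
decided (yes a) _ = a
decided (no _)  ()

cycAdj-sym : ∀ {n} (i j : Fin (suc n)) → cycAdj (suc n) i j ≡ cycAdj (suc n) j i
cycAdj-sym {n} i j = ∨-comm (does ((suc (toℕ i) % suc n) ≟ toℕ j)) _

cycAdj-next : ∀ {n} (i : Fin (suc n)) → cycAdj (suc n) i (next i) ≡ true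
cycAdj-next {n} i = cong (_∨ does ((suc (toℕ (next i)) % suc n) ≟ toℕ i)) (dec-true (_ ≟ _) (sym (toℕ-rot 1 i)))

cycAdj-prev : ∀ {n} (i : Fin (suc n)) → cycAdj (suc n) i (prev i) ≡ true
cycAdj-prev i = trans (cycAdj-sym i (prev i)) (subst (λ j → cycAdj _ (prev i) j ≡ true) (next-prev i) (cycAdj-next (prev i)))

cycAdj⇒next⊎prev : ∀ {n} (i j : Fin (suc n)) → cycAdj (suc n) i j ≡ true → j ≡ next i ⊎ j ≡ prev i
cycAdj⇒next⊎prev {n} i j adjacent with does ((suc (toℕ i) % suc n) ≟ toℕ j) in j-next
... | true  = inj₁ (toℕ-injective (sym (trans (toℕ-rot 1 i) (decided (_ ≟ _) j-next))))
... | false = inj₂ (trans (sym (prev-next j)) (cong prev next-j≡i))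
  where
  next-j≡i : next j ≡ i
  next-j≡i = toℕ-injective (trans (toℕ-rot 1 j) (decided (_ ≟ _) adjacent))

∑-cycle-neighbours : ∀ {a} (i : Fin (3 + a)) (g : Fin (3 + a) → ℕ) →
  ∑[ j < 3 + a ] (if cycAdj (3 + a) i j then g j else 0) ≡ g (next i) + g (prev i)
∑-cycle-neighbours i g = ∑-two-points _ (cycAdj _ i) g (next i) (prev i) (next≢prev i)
  (cycAdj-next i) (cycAdj-prev i) (cycAdj⇒next⊎prev i)

adj-combine : ∀ (G H : Graph) i j c d →
  adj (G ×ᵍ H) (combine i j) (combine c d) ≡ (adj G i c ∧ adj H j d)
adj-combine G H i j c d = cong₂ (λ x y → adj G (proj₁ x) (proj₁ y) ∧ adj H (proj₂ x) (proj₂ y))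
  (remQuot-combine i j) (remQuot-combine c d)

labelAt : ∀ (G H : Graph) → Labeling (G ×ᵍ H) → Fin (order G) → Fin (order H) → ℕ
labelAt G H f c d = label (G ×ᵍ H) f (combine c d)

weight-product : ∀ (G H : Graph) (f : Labeling (G ×ᵍ H)) i j →
  weight (G ×ᵍ H) f (combine i j) ≡
  ∑[ c < order G ] (if adj G i c then ∑[ d < order H ] (if adj H j d then labelAt G H f c d else 0) else 0)
weight-product G H f i j = begin
  weight (G ×ᵍ H) f (combine i j)
    ≡⟨ sumᴸ-allFin (order G * order H) neighbourLabel ⟩
  ∑[ x < order G * order H ] neighbourLabel x
    ≡⟨ ∑-combine (order G) (order H) neighbourLabel ⟩
  ∑[ c < order G ] ∑[ d < order H ] neighbourLabel (combine c d)
    ≡⟨ sum-cong-≗ (λ c → trans (sum-cong-≗ (nested c)) (∑-if (adj G i c) (neighboursIn c))) ⟩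
  ∑[ c < order G ] (if adj G i c then sum (neighboursIn c) else 0) ∎
  where
  open ≡-Reasoning
  neighbourLabel : Fin (order G * order H) → ℕ
  neighbourLabel y = if adj (G ×ᵍ H) (combine i j) y then label (G ×ᵍ H) f y else 0
  neighboursIn : Fin (order G) → Fin (order H) → ℕ
  neighboursIn c d = if adj H j d then labelAt G H f c d else 0
  nested : ∀ c d → neighbourLabel (combine c d) ≡
    (if adj G i c then (if adj H j d then labelAt G H f c d else 0) else 0)
  nested c d rewrite adj-combine G H i j c d with adj G i c
  ... | true  = refl
  ... | false = refl
  ∑-if : ∀ {n} b (h : Fin n → ℕ) → ∑[ d < n ] (if b then h d else 0) ≡ (if b then sum h else 0)
  ∑-if true  h = refl
  ∑-if {n} false h = sum-replicate-zero n

weight-square : ∀ {a b} (f : Labeling (Cycle (3 + a) ×ᵍ Cycle (3 + b))) i j →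
  let ℓ = labelAt (Cycle (3 + a)) (Cycle (3 + b)) f in
  weight (Cycle (3 + a) ×ᵍ Cycle (3 + b)) f (combine i j) ≡
    (ℓ (next i) (next j) + ℓ (next i) (prev j)) + (ℓ (prev i) (next j) + ℓ (prev i) (prev j))
weight-square {a} {b} f i j = trans (weight-product (Cycle (3 + a)) (Cycle (3 + b)) f i j)
  (trans (sum-cong-≗ λ c → cong (if cycAdj (3 + a) i c then_else 0) (∑-cycle-neighbours j (ℓ c)))
         (∑-cycle-neighbours i (λ c → ℓ c (next j) + ℓ c (prev j))))
  where ℓ = labelAt (Cycle (3 + a)) (Cycle (3 + b)) f

record _≅_ (X Y : Graph) : Set where
  field
    bijection     : Permutation (order X) (order Y)
    preserves-adj : ∀ x y → adj Y (bijection ⟨$⟩ʳ x) (bijection ⟨$⟩ʳ y) ≡ adj X x y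

module Pullback {X Y : Graph} (φ : X ≅ Y) where
  open _≅_ φ

  pullback : Labeling Y → Labeling X
  pullback f = (bijection ∘ₚ f) ∘ₚ cast-id (sym (↔⇒≡ bijection))

  label-pullback : ∀ f x → label X (pullback f) x ≡ label Y f (bijection ⟨$⟩ʳ x)
  label-pullback f x = cong suc (toℕ-cast _ _)

  weight-pullback : ∀ f x → weight X (pullback f) x ≡ weight Y f (bijection ⟨$⟩ʳ x)
  weight-pullback f x = begin
    weight X (pullback f) x
      ≡⟨ sumᴸ-allFin (order X) _ ⟩
    ∑[ y < order X ] (if adj X x y then label X (pullback f) y else 0)
      ≡⟨ sum-cong-≗ (λ y → cong₂ (λ b v → if b then v else 0) (sym (preserves-adj x y)) (label-pullback f y)) ⟩
    ∑[ y < order X ] neighbourLabel (bijection ⟨$⟩ʳ y)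
      ≡⟨ ∑-permute neighbourLabel bijection ⟨
    ∑[ z < order Y ] neighbourLabel z
      ≡⟨ sumᴸ-allFin (order Y) neighbourLabel ⟨
    weight Y f (bijection ⟨$⟩ʳ x) ∎
    where
    open ≡-Reasoning
    neighbourLabel : Fin (order Y) → ℕ
    neighbourLabel z = if adj Y (bijection ⟨$⟩ʳ x) z then label Y f z else 0

  balanced-pullback : ∀ f → IsBalancedLabeling Y f → IsBalancedLabeling X (pullback f)
  balanced-pullback f balanced w u w~u = v , w~v , complementary
    where
    partner : Σ (Fin (order Y)) λ v′ → adj Y (bijection ⟨$⟩ʳ w) v′ ≡ true × label Y f v′ ≡ (order Y + 1) ∸ label Y f (bijection ⟨$⟩ʳ u)
    partner = balanced (bijection ⟨$⟩ʳ w) (bijection ⟨$⟩ʳ u) (trans (preserves-adj w u) w~u)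
    v = bijection ⟨$⟩ˡ proj₁ partner
    φv≡partner : bijection ⟨$⟩ʳ v ≡ proj₁ partner
    φv≡partner = inverseʳ bijection
    w~v : adj X w v ≡ true
    w~v = trans (sym (preserves-adj w v)) (trans (cong (adj Y _) φv≡partner) (proj₁ (proj₂ partner)))
    complementary : label X (pullback f) v ≡ (order X + 1) ∸ label X (pullback f) u
    complementary = begin
      label X (pullback f) v                        ≡⟨ label-pullback f v ⟩
      label Y f (bijection ⟨$⟩ʳ v)                  ≡⟨ cong (label Y f) φv≡partner ⟩
      label Y f (proj₁ partner)                     ≡⟨ proj₂ (proj₂ partner) ⟩
      (order Y + 1) ∸ label Y f (bijection ⟨$⟩ʳ u)  ≡⟨ cong₂ (λ N l → (N + 1) ∸ l) (↔⇒≡ bijection) (label-pullback f u) ⟨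
      (order X + 1) ∸ label X (pullback f) u        ∎
      where open ≡-Reasoning

  distance-magic-invariant : IsDistanceMagic Y → IsDistanceMagic X
  distance-magic-invariant (f , k , k≥1 , magic) =
    pullback f , k , k≥1 , λ x → trans (weight-pullback f x) (magic _)

  balanced-invariant : IsBalancedDistanceMagic Y → IsBalancedDistanceMagic X
  balanced-invariant (magic , even , f , balanced) =
    distance-magic-invariant magic , subst Even (sym (↔⇒≡ bijection)) even , pullback f , balanced-pullback f balanced

open Pullback using (distance-magic-invariant; balanced-invariant)

×ᵍ-comm : ∀ G H → (G ×ᵍ H) ≅ (H ×ᵍ G)
×ᵍ-comm G H = record
  { bijection     = ↔-trans (*↔× {order G} {order H}) (↔-trans (×-comm _ _) (↔-sym *↔×))
  ; preserves-adj = λ x y → let (i , j) = remQuot (order H) x; (i′ , j′) = remQuot (order H) y in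
      trans (adj-combine H G j i j′ i′) (∧-comm (adj H j j′) (adj G i i′))
  }

label-injective : ∀ (X : Graph) (f : Labeling X) x y → label X f x ≡ label X f y → x ≡ y
label-injective X f x y eq = begin
  x                    ≡⟨ inverseˡ f ⟨
  f ⟨$⟩ˡ (f ⟨$⟩ʳ x)    ≡⟨ cong (f ⟨$⟩ˡ_) (toℕ-injective (suc-injective eq)) ⟩
  f ⟨$⟩ˡ (f ⟨$⟩ʳ y)    ≡⟨ inverseˡ f ⟩
  y                    ∎
  where open ≡-Reasoning

double-injective : ∀ x y → x + x ≡ y + y → x ≡ y
double-injective x y eq = trans (n≡⌊n+n/2⌋ x) (trans (cong ⌊_/2⌋ eq) (sym (n≡⌊n+n/2⌋ y)))

two-plus-four-multiple : ∀ K → K % 4 ≢ 0 → ∃₂ λ s c → 2 + s * 4 ≡ c * K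
two-plus-four-multiple K K%4≢0 = by-remainder (K % 4) (K / 4) (m%n<n K 4) K%4≢0 (m≡m%n+[m/n]*n K 4)
  where
  by-remainder : ∀ r q → r < 4 → r ≢ 0 → K ≡ r + q * 4 → ∃₂ λ s c → 2 + s * 4 ≡ c * K
  by-remainder 0 q _ r≢0 _ = ⊥-elim (r≢0 refl)
  by-remainder 1 q _ _ refl = q + q , 2 , solve (q ∷ [])
  by-remainder 2 q _ _ refl = q , 1 , solve (q ∷ [])
  by-remainder 3 q _ _ refl = suc (q + q) , 2 , solve (q ∷ [])
  by-remainder (suc (suc (suc (suc _)))) q (s≤s (s≤s (s≤s (s≤s ())))) _ _

-- On a cycle C_K with 4 ∤ K, if T(j + 1) + T(j - 1) = k for every j then 2 T(j) = k:
-- T is 4-periodic, and shifting by 2 + 4s for a suitable s is the identity.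
alternating-sum⇒constant : ∀ {n} (T : Fin (suc n) → ℕ) k → suc n % 4 ≢ 0 →
  (∀ j → T (next j) + T (prev j) ≡ k) → ∀ j → T j + T j ≡ k
alternating-sum⇒constant {n} T k K%4≢0 alternating j = begin
  T j + T j                   ≡⟨ cong (_+ T j) (cong T shift-is-identity) ⟨
  T (rot 2 z) + T j           ≡⟨ cong (T (rot 2 z) +_) (period s j) ⟨
  T (rot 2 z) + T z           ≡⟨ two-apart z ⟩
  k                           ∎
  where
  open ≡-Reasoning
  two-apart : ∀ y → T (rot 2 y) + T y ≡ k
  two-apart y = subst₂ (λ u v → T u + T v ≡ k) (rot-rot 1 1 y) (prev-next y) (alternating (next y))
  period : ∀ s y → T (rot (s * 4) y) ≡ T y
  period zero    y = cong T (rot-period 0 y)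
  period (suc s) y = begin
    T (rot (4 + s * 4) y)   ≡⟨ cong T (rot-rot 2 (2 + s * 4) y) ⟨
    T (rot 2 middle)        ≡⟨ +-cancelʳ-≡ (T middle) _ _ (trans (two-apart middle) (sym before-middle)) ⟩
    T (rot (s * 4) y)       ≡⟨ period s y ⟩
    T y                     ∎
    where
    middle = rot (2 + s * 4) y
    before-middle : T (rot (s * 4) y) + T middle ≡ k
    before-middle = trans (+-comm (T (rot (s * 4) y)) _)
      (subst (λ u → T u + T (rot (s * 4) y) ≡ k) (rot-rot 2 (s * 4) y) (two-apart (rot (s * 4) y)))
  s = proj₁ (two-plus-four-multiple (suc n) K%4≢0)
  z = rot (s * 4) j
  shift-is-identity : rot 2 z ≡ j
  shift-is-identity = begin
    rot 2 z              ≡⟨ rot-rot 2 (s * 4) j ⟩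
    rot (2 + s * 4) j    ≡⟨ cong (λ t → rot t j) (proj₂ (proj₂ (two-plus-four-multiple (suc n) K%4≢0))) ⟩
    rot (c * suc n) j    ≡⟨ rot-period c j ⟩
    j                    ∎
    where c = proj₁ (proj₂ (two-plus-four-multiple (suc n) K%4≢0))

four-steps-return : ∀ a → next (next (next (next (zero {2 + a})))) ≡ zero → 3 + a ≡ 4
four-steps-return a returns = by-length a (begin
  4 % (3 + a)                           ≡⟨ toℕ-rot 4 zero ⟨
  toℕ (rot 4 zero)                      ≡⟨ cong toℕ (rot-rot 1 3 zero) ⟨
  toℕ (next (rot 3 zero))               ≡⟨ cong (toℕ ∘ next) (trans (rot-rot 1 2 zero) (cong next (rot-rot 1 1 zero))) ⟨
  toℕ (next (next (next (next zero))))  ≡⟨ cong toℕ returns ⟩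
  0                                     ∎)
  where
  open ≡-Reasoning
  by-length : ∀ a → 4 % (3 + a) ≡ 0 → 3 + a ≡ 4
  by-length 0             ()
  by-length 1             _ = refl
  by-length (suc (suc a)) ()

-- Necessity: if C_M × C_K is distance magic and 4 ∤ K then M = 4. The label sums T(i,j) of the
-- vertical neighbour pairs satisfy T(i,j+1) + T(i,j-1) = k, so 2 T(i,j) = k for all i, j;
-- comparing T(0,0) with T(2,0) gives ℓ(-1,0) = ℓ(3,0), i.e. -1 ≡ 3 (mod M).
distance-magic⇒length-4 : ∀ {a b} → IsDistanceMagic (Cycle (3 + a) ×ᵍ Cycle (3 + b)) →
  (3 + b) % 4 ≢ 0 → 3 + a ≡ 4
distance-magic⇒length-4 {a} {b} (f , k , _ , magic) K%4≢0 = four-steps-return a returns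
  where
  open ≡-Reasoning
  X = Cycle (3 + a) ×ᵍ Cycle (3 + b)
  ℓ = labelAt (Cycle (3 + a)) (Cycle (3 + b)) f
  T : Fin (3 + a) → Fin (3 + b) → ℕ
  T i j = ℓ (next i) j + ℓ (prev i) j
  doubled : ∀ i j → T i j + T i j ≡ k
  doubled i = alternating-sum⇒constant (T i) k K%4≢0 λ j → begin
    T i (next j) + T i (prev j)        ≡⟨ interchange (ℓ (next i) (next j)) _ _ _ ⟨
    _                                  ≡⟨ weight-square f i j ⟨
    weight X f (combine i j)           ≡⟨ magic (combine i j) ⟩
    k                                  ∎
  i₂ = next (next zero)
  same-T : T zero zero ≡ T i₂ zero
  same-T = double-injective _ _ (trans (doubled zero zero) (sym (doubled i₂ zero)))
  same-label : ℓ (prev zero) zero ≡ ℓ (next i₂) zero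
  same-label = +-cancelˡ-≡ (ℓ (next zero) zero) _ _ (begin
    T zero zero                                 ≡⟨ same-T ⟩
    ℓ (next i₂) zero + ℓ (prev i₂) zero         ≡⟨ cong (λ c → ℓ (next i₂) zero + ℓ c zero) (prev-next (next zero)) ⟩
    ℓ (next i₂) zero + ℓ (next zero) zero       ≡⟨ +-comm (ℓ (next i₂) zero) _ ⟩
    ℓ (next zero) zero + ℓ (next i₂) zero       ∎)
  prev-zero : prev zero ≡ next i₂
  prev-zero = combine-injectiveˡ _ zero _ zero (label-injective X f _ _ same-label)
  returns : next (next i₂) ≡ zero
  returns = trans (cong next (sym prev-zero)) (next-prev zero)

∧-true : ∀ p q → (p ∧ q) ≡ true → p ≡ true × q ≡ true
∧-true true true _ = refl , refl

cycAdj-next-back : ∀ {n} (i : Fin (suc n)) → cycAdj (suc n) (next i) i ≡ true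
cycAdj-next-back i = trans (cycAdj-sym (next i) i) (cycAdj-next i)

cycAdj-prev-back : ∀ {n} (i : Fin (suc n)) → cycAdj (suc n) (prev i) i ≡ true
cycAdj-prev-back i = trans (cycAdj-sym (prev i) i) (cycAdj-prev i)

common-neighbour : ∀ {a} (c : Fin (3 + a)) → 3 + a ≢ 4 →
  cycAdj (3 + a) (next zero) c ≡ true → cycAdj (3 + a) (prev zero) c ≡ true → c ≡ zero
common-neighbour {a} c M≢4 c~1 c~-1 with cycAdj⇒next⊎prev (next zero) c c~1 | cycAdj⇒next⊎prev (prev zero) c c~-1
... | inj₂ c≡prev-1 | _                = trans c≡prev-1 (prev-next zero)
... | inj₁ _        | inj₁ c≡next-prev = trans c≡next-prev (next-prev zero)
... | inj₁ c≡2      | inj₂ c≡-2        = ⊥-elim (M≢4 (four-steps-return a (begin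
  next (next (next (next zero)))   ≡⟨ cong (next ∘ next) (trans (sym c≡2) c≡-2) ⟩
  next (next (prev (prev zero)))   ≡⟨ cong next (next-prev (prev zero)) ⟩
  next (prev zero)                 ≡⟨ next-prev zero ⟩
  zero                             ∎)))
  where open ≡-Reasoning

self-complementary⇒odd : ∀ N l → l ≤ N + 1 → l ≡ (N + 1) ∸ l → ∀ t → N ≢ t + t
self-complementary⇒odd N l l≤N+1 l≡complement t N≡t+t = even≢odd l t (begin
  2 * l                 ≡⟨ cong (l +_) (+-identityʳ l) ⟩
  l + l                 ≡⟨ cong (l +_) l≡complement ⟩
  l + ((N + 1) ∸ l)     ≡⟨ m+[n∸m]≡n l≤N+1 ⟩
  N + 1                 ≡⟨ +-comm N 1 ⟩
  suc N                 ≡⟨ cong suc N≡t+t ⟩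
  suc (t + t)           ≡⟨ cong (λ x → suc (t + x)) (+-identityʳ t) ⟨
  suc (2 * t)           ∎)
  where open ≡-Reasoning

-- The
-- vertices (1,1) and (-1,-1) are both adjacent to u = (0,0), whose only common neighbour is u;
-- so balancing u in both neighbourhoods forces ℓ(u) = N + 1 - ℓ(u), with N + 1 odd.
no-balanced-labeling : ∀ {a b} (f : Labeling (Cycle (3 + a) ×ᵍ Cycle (3 + b))) →
  Even (order (Cycle (3 + a) ×ᵍ Cycle (3 + b))) → IsBalancedLabeling (Cycle (3 + a) ×ᵍ Cycle (3 + b)) f →
  3 + a ≢ 4 → 3 + b ≢ 4 → ⊥
no-balanced-labeling {a} {b} f (t , N≡t+t) balanced M≢4 K≢4 =
  self-complementary⇒odd N (label X f u) (≤-trans (toℕ<n (f ⟨$⟩ʳ u)) (m≤m+n N 1))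
    (trans (cong (label X f) (sym v≡u)) (proj₂ (proj₂ partner₁))) t N≡t+t
  where
  X = Cycle (3 + a) ×ᵍ Cycle (3 + b)
  N = order X
  vertex : Fin (3 + a) → Fin (3 + b) → Fin N
  vertex = combine
  u w₁ w₂ : Fin N
  u  = vertex zero zero
  w₁ = vertex (next zero) (next zero)
  w₂ = vertex (prev zero) (prev zero)
  Partner : Fin N → Set
  Partner w = Σ (Fin N) λ v → adj X w v ≡ true × label X f v ≡ (N + 1) ∸ label X f u
  partner₁ : Partner w₁
  partner₂ : Partner w₂
  partner₁ = balanced w₁ u (trans (adj-combine (Cycle (3 + a)) (Cycle (3 + b)) (next zero) (next zero) zero zero)
                                  (cong₂ _∧_ (cycAdj-next-back {2 + a} zero) (cycAdj-next-back {2 + b} zero)))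
  partner₂ = balanced w₂ u (trans (adj-combine (Cycle (3 + a)) (Cycle (3 + b)) (prev zero) (prev zero) zero zero)
                                  (cong₂ _∧_ (cycAdj-prev-back {2 + a} zero) (cycAdj-prev-back {2 + b} zero)))
  v = proj₁ partner₁
  v≡partner₂ : v ≡ proj₁ partner₂
  v≡partner₂ = label-injective X f _ _ (trans (proj₂ (proj₂ partner₁)) (sym (proj₂ (proj₂ partner₂))))
  c = proj₁ (remQuot {3 + a} (3 + b) v)
  d = proj₂ (remQuot {3 + a} (3 + b) v)
  v≡cd : v ≡ vertex c d
  v≡cd = sym (combine-remQuot (3 + b) v)
  adjacent-to : ∀ i j → adj X (vertex i j) v ≡ true → cycAdj (3 + a) i c ≡ true × cycAdj (3 + b) j d ≡ true
  adjacent-to i j w~v = ∧-true (cycAdj (3 + a) i c) (cycAdj (3 + b) j d)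
    (trans (sym (adj-combine (Cycle (3 + a)) (Cycle (3 + b)) i j c d)) (subst (λ y → adj X (vertex i j) y ≡ true) v≡cd w~v))
  v~w₁ : cycAdj (3 + a) (next zero) c ≡ true × cycAdj (3 + b) (next zero) d ≡ true
  v~w₁ = adjacent-to (next zero) (next zero) (proj₁ (proj₂ partner₁))
  v~w₂ : cycAdj (3 + a) (prev zero) c ≡ true × cycAdj (3 + b) (prev zero) d ≡ true
  v~w₂ = adjacent-to (prev zero) (prev zero) (subst (λ y → adj X w₂ y ≡ true) (sym v≡partner₂) (proj₁ (proj₂ partner₂)))
  v≡u : v ≡ u
  v≡u = trans v≡cd (cong₂ vertex (common-neighbour c M≢4 (proj₁ v~w₁) (proj₁ v~w₂))
                                   (common-neighbour d K≢4 (proj₂ v~w₁) (proj₂ v~w₂)))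

opposite-complement : ∀ {n} (i : Fin n) → toℕ i + suc (toℕ (opposite i)) ≡ n
opposite-complement {suc n} i = begin
  toℕ i + suc (toℕ (opposite i))   ≡⟨ +-suc (toℕ i) _ ⟩
  suc (toℕ i + toℕ (opposite i))   ≡⟨ cong (λ x → suc (toℕ i + x)) (opposite-prop i) ⟩
  suc (toℕ i + (n ∸ toℕ i))        ≡⟨ cong suc (m+[n∸m]≡n (s≤s⁻¹ (toℕ<n i))) ⟩
  suc n                            ∎
  where open ≡-Reasoning

opposite-combine : ∀ {m n} (x : Fin m) (y : Fin n) → combine (opposite x) (opposite y) ≡ opposite (combine x y)
opposite-combine {suc m} {n} x y = toℕ-injective (suc-injective (+-cancelˡ-≡ (toℕ (combine x y)) _ _ (begin
  toℕ (combine x y) + suc (toℕ (combine x̄ ȳ))        ≡⟨ cong₂ (λ s t → s + suc t) (toℕ-combine x y) (toℕ-combine x̄ ȳ) ⟩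
  n * toℕ x + toℕ y + suc (n * toℕ x̄ + toℕ ȳ)        ≡⟨ rearrange n (toℕ x) (toℕ y) (toℕ x̄) (toℕ ȳ) ⟩
  n * (toℕ x + toℕ x̄) + (toℕ y + suc (toℕ ȳ))        ≡⟨ cong₂ (λ s t → n * s + t) x+x̄ (opposite-complement y) ⟩
  n * m + n                                           ≡⟨ +-comm (n * m) n ⟩
  n + n * m                                           ≡⟨ *-suc n m ⟨
  n * suc m                                           ≡⟨ *-comm n (suc m) ⟩
  suc m * n                                           ≡⟨ opposite-complement (combine x y) ⟨
  toℕ (combine x y) + suc (toℕ (opposite (combine x y))) ∎)))
  where
  open ≡-Reasoning
  x̄ = opposite x
  ȳ = opposite y
  rearrange : ∀ n a b a′ b′ → n * a + b + suc (n * a′ + b′) ≡ n * (a + a′) + (b + suc b′)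
  rearrange = solve-∀
  x+x̄ : toℕ x + toℕ x̄ ≡ m
  x+x̄ = suc-injective (trans (sym (+-suc (toℕ x) (toℕ x̄))) (opposite-complement x))

complementary⇒balanced : ∀ (X : Graph) (f : Labeling X) (π : Fin (order X) → Fin (order X)) →
  (∀ w u → adj X w (π u) ≡ adj X w u) → (∀ u → label X f u + label X f (π u) ≡ order X + 1) →
  IsBalancedLabeling X f
complementary⇒balanced X f π same-neighbours complementary w u w~u =
  π u , trans (same-neighbours w u) w~u ,
  sym (trans (cong (_∸ label X f u) (sym (complementary u))) (m+n∸m≡n (label X f u) _))

by-coordinates : ∀ {m n} (P : Fin (m * n) → Set) → (∀ i j → P (combine i j)) → ∀ x → P x
by-coordinates {m} {n} P h x = subst P (combine-remQuot {m} n x) (h (proj₁ (remQuot {m} n x)) (proj₂ (remQuot {m} n x)))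

-- The vertex (c , d) gets the
-- label 1 + combine (σ c) (τ c d): row c fills the block σ c of the labels, in the column order
-- τ c. Rows c and c + 2 occupy opposite blocks in opposite orders, so antipodal vertices carry
-- complementary labels; as (i + 1 , j) and (i - 1 , j) are antipodal, every weight is 2(N + 1).
module FourByK (b : ℕ) where
  K N : ℕ
  K = 3 + b
  N = 4 * K

  X : Graph
  X = Cycle 4 ×ᵍ Cycle K

  antipode : Fin 4 → Fin 4
  antipode c = next (next c)

  σ : Fin 4 → Fin 4
  σ zero                   = zero
  σ (suc zero)             = suc zero
  σ (suc (suc zero))       = suc (suc (suc zero))
  σ (suc (suc (suc zero))) = suc (suc zero)

  τ : Fin 4 → Fin K → Fin K
  τ zero                   = id
  τ (suc zero)             = id
  τ (suc (suc zero))       = opposite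
  τ (suc (suc (suc zero))) = opposite

  σ-antipode : ∀ c → σ (antipode c) ≡ opposite (σ c)
  σ-antipode zero                   = refl
  σ-antipode (suc zero)             = refl
  σ-antipode (suc (suc zero))       = refl
  σ-antipode (suc (suc (suc zero))) = refl

  τ-antipode : ∀ c d → τ (antipode c) d ≡ opposite (τ c d)
  τ-antipode zero                   d = refl
  τ-antipode (suc zero)             d = refl
  τ-antipode (suc (suc zero))       d = sym (opposite-involutive d)
  τ-antipode (suc (suc (suc zero))) d = sym (opposite-involutive d)

  στ-involutive : ∀ c d → (σ (σ c) , τ (σ c) (τ c d)) ≡ (c , d)
  στ-involutive zero                   d = refl
  στ-involutive (suc zero)             d = refl
  στ-involutive (suc (suc zero))       d = cong (_ ,_) (opposite-involutive d)
  στ-involutive (suc (suc (suc zero))) d = cong (_ ,_) (opposite-involutive d)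

  Φ : Fin N → Fin N
  Φ x = combine (σ (proj₁ (remQuot {4} K x))) (τ (proj₁ (remQuot {4} K x)) (proj₂ (remQuot {4} K x)))

  Φ-combine : ∀ c d → Φ (combine c d) ≡ combine (σ c) (τ c d)
  Φ-combine c d = cong (λ (p : Fin 4 × Fin K) → combine (σ (proj₁ p)) (τ (proj₁ p) (proj₂ p))) (remQuot-combine c d)

  Φ-involutive : ∀ x → Φ (Φ x) ≡ x
  Φ-involutive = by-coordinates {4} {K} (λ x → Φ (Φ x) ≡ x) λ c d →
    trans (cong Φ (Φ-combine c d)) (trans (Φ-combine (σ c) (τ c d))
          (cong (λ (p : Fin 4 × Fin K) → combine (proj₁ p) (proj₂ p)) (στ-involutive c d)))

  f : Labeling X
  f = permutation Φ Φ Φ-involutive Φ-involutive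

  ℓ : Fin 4 → Fin K → ℕ
  ℓ = labelAt (Cycle 4) (Cycle K) f

  antipodal-complementary : ∀ c d → ℓ c d + ℓ (antipode c) d ≡ N + 1
  antipodal-complementary c d = begin
    suc (toℕ x) + suc (toℕ (Φ (combine (antipode c) d)))
      ≡⟨ cong (λ y → suc (toℕ x) + suc (toℕ y)) (Φ-combine (antipode c) d) ⟩
    suc (toℕ x) + suc (toℕ (combine (σ (antipode c)) (τ (antipode c) d)))
      ≡⟨ cong (λ y → suc (toℕ x) + suc (toℕ y)) (cong₂ combine (σ-antipode c) (τ-antipode c d)) ⟩
    suc (toℕ x) + suc (toℕ (combine (opposite (σ c)) (opposite (τ c d))))
      ≡⟨ cong (λ y → suc (toℕ x) + suc (toℕ y)) (trans (opposite-combine (σ c) (τ c d)) (cong opposite (sym (Φ-combine c d)))) ⟩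
    suc (toℕ x + suc (toℕ (opposite x)))
      ≡⟨ cong suc (opposite-complement x) ⟩
    suc N
      ≡⟨ +-comm 1 N ⟩
    N + 1 ∎
    where
    open ≡-Reasoning
    x = Φ (combine c d)

  prev≡antipode-next : ∀ i → prev i ≡ antipode (next i)
  prev≡antipode-next zero                   = refl
  prev≡antipode-next (suc zero)             = refl
  prev≡antipode-next (suc (suc zero))       = refl
  prev≡antipode-next (suc (suc (suc zero))) = refl

  antipode-neighbours : ∀ i c → cycAdj 4 i (antipode c) ≡ cycAdj 4 i c
  antipode-neighbours zero                   zero                   = refl
  antipode-neighbours zero                   (suc zero)             = refl
  antipode-neighbours zero                   (suc (suc zero))       = refl
  antipode-neighbours zero                   (suc (suc (suc zero))) = refl
  antipode-neighbours (suc zero)             zero                   = refl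
  antipode-neighbours (suc zero)             (suc zero)             = refl
  antipode-neighbours (suc zero)             (suc (suc zero))       = refl
  antipode-neighbours (suc zero)             (suc (suc (suc zero))) = refl
  antipode-neighbours (suc (suc zero))       zero                   = refl
  antipode-neighbours (suc (suc zero))       (suc zero)             = refl
  antipode-neighbours (suc (suc zero))       (suc (suc zero))       = refl
  antipode-neighbours (suc (suc zero))       (suc (suc (suc zero))) = refl
  antipode-neighbours (suc (suc (suc zero))) zero                   = refl
  antipode-neighbours (suc (suc (suc zero))) (suc zero)             = refl
  antipode-neighbours (suc (suc (suc zero))) (suc (suc zero))       = refl
  antipode-neighbours (suc (suc (suc zero))) (suc (suc (suc zero))) = refl

  -- The square around a vertex consists of two antipodal pairs.
  magic : ∀ x → weight X f x ≡ (N + 1) + (N + 1)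
  magic = by-coordinates {4} {K} (λ x → weight X f x ≡ (N + 1) + (N + 1)) λ i j → begin
    weight X f (combine i j)
      ≡⟨ weight-square f i j ⟩
    (ℓ (next i) (next j) + ℓ (next i) (prev j)) + (ℓ (prev i) (next j) + ℓ (prev i) (prev j))
      ≡⟨ interchange (ℓ (next i) (next j)) _ _ _ ⟩
    (ℓ (next i) (next j) + ℓ (prev i) (next j)) + (ℓ (next i) (prev j) + ℓ (prev i) (prev j))
      ≡⟨ cong (λ a → (ℓ (next i) (next j) + ℓ a (next j)) + (ℓ (next i) (prev j) + ℓ a (prev j))) (prev≡antipode-next i) ⟩
    (ℓ (next i) (next j) + ℓ (antipode (next i)) (next j)) + (ℓ (next i) (prev j) + ℓ (antipode (next i)) (prev j))
      ≡⟨ cong₂ _+_ (antipodal-complementary (next i) (next j)) (antipodal-complementary (next i) (prev j)) ⟩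
    (N + 1) + (N + 1) ∎
    where open ≡-Reasoning

  π : Fin N → Fin N
  π x = combine (antipode (proj₁ (remQuot {4} K x))) (proj₂ (remQuot {4} K x))

  π-combine : ∀ c d → π (combine c d) ≡ combine (antipode c) d
  π-combine c d = cong (λ (p : Fin 4 × Fin K) → combine (antipode (proj₁ p)) (proj₂ p)) (remQuot-combine c d)

  same-neighbours : ∀ w u → adj X w (π u) ≡ adj X w u
  same-neighbours = by-coordinates {4} {K} _ λ i j → by-coordinates {4} {K} _ λ c d → begin
    adj X (combine i j) (π (combine c d))             ≡⟨ cong (adj X (combine i j)) (π-combine c d) ⟩
    adj X (combine i j) (combine (antipode c) d)      ≡⟨ adj-combine (Cycle 4) (Cycle K) i j (antipode c) d ⟩
    cycAdj 4 i (antipode c) ∧ cycAdj K j d            ≡⟨ cong (_∧ cycAdj K j d) (antipode-neighbours i c) ⟩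
    cycAdj 4 i c ∧ cycAdj K j d                       ≡⟨ adj-combine (Cycle 4) (Cycle K) i j c d ⟨
    adj X (combine i j) (combine c d)                 ∎
    where open ≡-Reasoning

  complementary : ∀ u → label X f u + label X f (π u) ≡ N + 1
  complementary = by-coordinates {4} {K} _ λ c d →
    trans (cong (λ v → ℓ c d + label X f v) (π-combine c d)) (antipodal-complementary c d)

  balanced-distance-magic : IsBalancedDistanceMagic X
  balanced-distance-magic =
    (f , (N + 1) + (N + 1) , s≤s z≤n , magic) ,
    (K + K , four-times K) ,
    (f , complementary⇒balanced X f π same-neighbours complementary)
    where
    four-times : ∀ k → 4 * k ≡ (k + k) + (k + k)
    four-times = solve-∀

-- An injective endomap of Fin n is onto, by the pigeonhole principle: otherwise it would
-- inject Fin n into the complement of the missed point.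
injective⇒onto : ∀ {n} (g : Fin n → Fin n) → (∀ x y → g x ≡ g y → x ≡ y) → ∀ y → Σ (Fin n) λ x → g x ≡ y
injective⇒onto {suc m} g g-injective y with any? (λ x → g x ≟ᶠ y)
... | yes hit = hit
... | no miss = ⊥-elim (<⇒≢ᶠ i<j (g-injective i j (punchOut-injective (y≢g i) (y≢g j) collision)))
  where
  y≢g : ∀ x → y ≢ g x
  y≢g x y≡gx = miss (x , sym y≡gx)
  pigeons = pigeonhole (n<1+n m) (λ x → punchOut (y≢g x))
  i = proj₁ pigeons
  j = proj₁ (proj₂ pigeons)
  i<j = proj₁ (proj₂ (proj₂ pigeons))
  collision = proj₂ (proj₂ (proj₂ pigeons))

injective⇒permutation : ∀ {n} (g : Fin n → Fin n) → (∀ x y → g x ≡ g y → x ≡ y) → Permutation n n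
injective⇒permutation g g-injective = permutation g (proj₁ ∘ onto) (proj₂ ∘ onto) (λ x → g-injective _ _ (proj₂ (onto (g x))))
  where onto = injective⇒onto g g-injective

-- Writing x = 4s + 2u + r with u, r ∈ {0, 1}, the vertices x and
-- x + 2 form a pair; `pairIndex x` = 2s + r numbers the pairs and `side x` = u tells the two
-- vertices of a pair apart.

pairIndex : ℕ → ℕ
pairIndex 0                           = 0
pairIndex 1                           = 1
pairIndex 2                           = 0
pairIndex 3                           = 1
pairIndex (suc (suc (suc (suc x))))   = 2 + pairIndex x

side : ℕ → Bool
side 0                         = false
side 1                         = false
side 2                         = true
side 3                         = true
side (suc (suc (suc (suc x)))) = side x

fromPair : ℕ → Bool → ℕ
fromPair 0             u = if u then 2 else 0
fromPair 1             u = if u then 3 else 1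
fromPair (suc (suc ρ)) u = 4 + fromPair ρ u

fromPair-pairIndex : ∀ x → fromPair (pairIndex x) (side x) ≡ x
fromPair-pairIndex 0                         = refl
fromPair-pairIndex 1                         = refl
fromPair-pairIndex 2                         = refl
fromPair-pairIndex 3                         = refl
fromPair-pairIndex (suc (suc (suc (suc x)))) = cong (4 +_) (fromPair-pairIndex x)

pairIndex-< : ∀ P x → x < P * 4 → pairIndex x < P * 2
pairIndex-< (suc P) 0                         _ = s≤s z≤n
pairIndex-< (suc P) 1                         _ = s≤s (s≤s z≤n)
pairIndex-< (suc P) 2                         _ = s≤s z≤n
pairIndex-< (suc P) 3                         _ = s≤s (s≤s z≤n)
pairIndex-< (suc P) (suc (suc (suc (suc x)))) (s≤s (s≤s (s≤s (s≤s x<)))) = s≤s (s≤s (pairIndex-< P x x<))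

side-+2 : ∀ x → side (2 + x) ≡ not (side x)
side-+2 0                         = refl
side-+2 1                         = refl
side-+2 2                         = refl
side-+2 3                         = refl
side-+2 (suc (suc (suc (suc x)))) = side-+2 x

side-periodic : ∀ t x → side (t * 4 + x) ≡ side x
side-periodic zero    x = refl
side-periodic (suc t) x = side-periodic t x

side-mod : ∀ p y → side (y % (suc p * 4)) ≡ side y
side-mod p y = begin
  side (y % M)                         ≡⟨ side-periodic (y / M * suc p) _ ⟨
  side (y / M * suc p * 4 + y % M)     ≡⟨ cong (λ z → side (z + y % M)) (*-assoc (y / M) (suc p) 4) ⟩
  side (y / M * M + y % M)             ≡⟨ cong side (trans (+-comm _ (y % M)) (sym (m≡m%n+[m/n]*n y M))) ⟩
  side y                               ∎
  where
  open ≡-Reasoning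
  M = suc p * 4

side-next² : ∀ p (i : Fin (suc p * 4)) → side (toℕ (next (next i))) ≡ not (side (toℕ i))
side-next² p i = begin
  side (toℕ (next (next i)))           ≡⟨ cong (side ∘ toℕ) (rot-rot 1 1 i) ⟩
  side (toℕ (rot 2 i))                 ≡⟨ cong side (toℕ-rot 2 i) ⟩
  side ((2 + toℕ i) % (suc p * 4))     ≡⟨ side-mod p (2 + toℕ i) ⟩
  side (2 + toℕ i)                     ≡⟨ side-+2 (toℕ i) ⟩
  not (side (toℕ i))                   ∎
  where open ≡-Reasoning

side-next-prev : ∀ p (i : Fin (suc p * 4)) → side (toℕ (next i)) ≡ not (side (toℕ (prev i)))
side-next-prev p i = trans (cong (side ∘ toℕ) (sym (cong next (next-prev i)))) (side-next² p (prev i))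

agree : Bool → Bool → Bool
agree u v = not (u xor v)

agree-notˡ : ∀ u v → agree (not u) v ≡ not (agree u v)
agree-notˡ true  true  = refl
agree-notˡ true  false = refl
agree-notˡ false true  = refl
agree-notˡ false false = refl

agree-notʳ : ∀ u v → agree u (not v) ≡ not (agree u v)
agree-notʳ true  true  = refl
agree-notʳ true  false = refl
agree-notʳ false true  = refl
agree-notʳ false false = refl

agree-not-not : ∀ u v → agree (not u) (not v) ≡ agree u v
agree-not-not true  true  = refl
agree-not-not true  false = refl
agree-not-not false true  = refl
agree-not-not false false = refl

agree-cancelʳ : ∀ u u′ v → agree u v ≡ agree u′ v → u ≡ u′
agree-cancelʳ true  true  v _ = refl
agree-cancelʳ false false v _ = refl
agree-cancelʳ true  false true  ()
agree-cancelʳ true  false false ()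
agree-cancelʳ false true  true  ()
agree-cancelʳ false true  false ()

inHalf : ∀ {h} → Bool → Fin h → Fin (h + h)
inHalf {h} true  c = h ↑ʳ c
inHalf {h} false c = opposite c ↑ˡ h

inHalf-injective : ∀ {h} s s′ (c c′ : Fin h) → inHalf s c ≡ inHalf s′ c′ → s ≡ s′ × c ≡ c′
inHalf-injective {h} true  true  c c′ eq = refl , ↑ʳ-injective h c c′ eq
inHalf-injective {h} false false c c′ eq =
  refl , trans (sym (opposite-involutive c)) (trans (cong opposite (↑ˡ-injective h _ _ eq)) (opposite-involutive c′))
inHalf-injective {h} true  false c c′ eq with () ←
  trans (sym (splitAt-↑ʳ h h c)) (trans (cong (splitAt h) eq) (splitAt-↑ˡ h (opposite c′) h))
inHalf-injective {h} false true  c c′ eq with () ←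
  trans (sym (splitAt-↑ˡ h (opposite c) h)) (trans (cong (splitAt h) eq) (splitAt-↑ʳ h h c′))

value : ∀ {h} → Bool → Fin h → ℕ
value s c = suc (toℕ (inHalf s c))

-- Four labels, two in each half, whose positions p, t and q, r have equal sums, add up to
-- 2(2h + 1): the upper-half labels exceed h by p and t, the lower-half ones fall short of h + 1
-- by q and r.
square-value : ∀ {h} s (p q r t : Fin h) → toℕ p + toℕ t ≡ toℕ q + toℕ r →
  (value s p + value (not s) q) + (value (not s) r + value s t) ≡ suc (h + h) + suc (h + h)
square-value {h} true p q r t balance = +-cancelʳ-≡ (toℕ q + toℕ r) _ _ (begin
  (suc (toℕ (h ↑ʳ p)) + suc (toℕ (opposite q ↑ˡ h))) + (suc (toℕ (opposite r ↑ˡ h)) + suc (toℕ (h ↑ʳ t))) + (toℕ q + toℕ r)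
    ≡⟨ cong₂ (λ x y → x + y + (toℕ q + toℕ r)) (cong₂ (λ x y → suc x + suc y) (toℕ-↑ʳ h p) (toℕ-↑ˡ (opposite q) h))
                                 (cong₂ (λ x y → suc x + suc y) (toℕ-↑ˡ (opposite r) h) (toℕ-↑ʳ h t)) ⟩
  (suc (h + toℕ p) + suc q̄) + (suc r̄ + suc (h + toℕ t)) + (toℕ q + toℕ r)
    ≡⟨ regroup h (toℕ p) (toℕ q) q̄ (toℕ r) r̄ (toℕ t) ⟩
  (toℕ q + suc q̄) + (toℕ r + suc r̄) + suc (suc (h + h)) + (toℕ p + toℕ t)
    ≡⟨ cong₂ (λ x y → x + y + suc (suc (h + h)) + (toℕ p + toℕ t)) (opposite-complement q) (opposite-complement r) ⟩
  h + h + suc (suc (h + h)) + (toℕ p + toℕ t)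
    ≡⟨ cong₂ _+_ (regroup-halves h) balance ⟩
  suc (h + h) + suc (h + h) + (toℕ q + toℕ r) ∎)
  where
  open ≡-Reasoning
  q̄ = toℕ (opposite q)
  r̄ = toℕ (opposite r)
  regroup : ∀ h p q q̄ r r̄ t → (suc (h + p) + suc q̄) + (suc r̄ + suc (h + t)) + (q + r) ≡
                              (q + suc q̄) + (r + suc r̄) + suc (suc (h + h)) + (p + t)
  regroup = solve-∀
  regroup-halves : ∀ h → h + h + suc (suc (h + h)) ≡ suc (h + h) + suc (h + h)
  regroup-halves = solve-∀
square-value false p q r t balance = begin
  (value false p + value true q) + (value true r + value false t)
    ≡⟨ cong₂ _+_ (+-comm (value false p) _) (+-comm (value true r) _) ⟩
  (value true q + value false p) + (value false t + value true r)
    ≡⟨ square-value true q p t r (sym balance) ⟩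
  _ ∎
  where open ≡-Reasoning

-- With h = N / 2, the vertex
-- (i , j) is assigned the cell (pair of i , j) of Fin h and the sign saying whether i and j lie
-- on the same side of their pairs; its label is 1 + inHalf sign cell. In the square around any
-- vertex the two diagonals have opposite signs and equal cell sums, so `square-value` makes
-- every weight 2(N + 1).
module MultiplesOf4 (p q : ℕ) where
  P M K N h : ℕ
  P = suc p
  M = P * 4
  K = suc q * 4
  N = M * K
  h = P * 2 * K

  X : Graph
  X = Cycle M ×ᵍ Cycle K

  N≡h+h : N ≡ h + h
  N≡h+h = halve P K
    where
    halve : ∀ P K → P * 4 * K ≡ P * 2 * K + P * 2 * K
    halve = solve-∀

  vertex : Fin M → Fin K → Fin N
  vertex = combine

  pairOf : Fin M → Fin (P * 2)
  pairOf i = fromℕ< (pairIndex-< P (toℕ i) (toℕ<n i))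

  cell : Fin M → Fin K → Fin h
  cell i j = combine (pairOf i) j

  sign : Fin M → Fin K → Bool
  sign i j = agree (side (toℕ i)) (side (toℕ j))

  index : Fin M → Fin K → Fin N
  index i j = cast (sym N≡h+h) (inHalf (sign i j) (cell i j))

  index-injective : ∀ i j i′ j′ → index i j ≡ index i′ j′ → vertex i j ≡ vertex i′ j′
  index-injective i j i′ j′ eq = cong₂ vertex i≡i′ j≡j′
    where
    open ≡-Reasoning
    halves = inHalf-injective (sign i j) (sign i′ j′) (cell i j) (cell i′ j′)
      (toℕ-injective (trans (sym (toℕ-cast _ _)) (trans (cong toℕ eq) (toℕ-cast _ _))))
    j≡j′ : j ≡ j′
    j≡j′ = combine-injectiveʳ (pairOf i) j (pairOf i′) j′ (proj₂ halves)
    same-pair : pairIndex (toℕ i) ≡ pairIndex (toℕ i′)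
    same-pair = trans (sym (toℕ-fromℕ< _))
      (trans (cong toℕ (combine-injectiveˡ (pairOf i) j (pairOf i′) j′ (proj₂ halves))) (toℕ-fromℕ< _))
    same-side : side (toℕ i) ≡ side (toℕ i′)
    same-side = agree-cancelʳ _ _ (side (toℕ j)) (trans (proj₁ halves) (cong (λ y → sign i′ y) (sym j≡j′)))
    i≡i′ : i ≡ i′
    i≡i′ = toℕ-injective (begin
      toℕ i                                        ≡⟨ fromPair-pairIndex (toℕ i) ⟨
      fromPair (pairIndex (toℕ i)) (side (toℕ i))  ≡⟨ cong₂ fromPair same-pair same-side ⟩
      fromPair (pairIndex (toℕ i′)) (side (toℕ i′)) ≡⟨ fromPair-pairIndex (toℕ i′) ⟩
      toℕ i′                                       ∎)

  Φ : Fin N → Fin N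
  Φ x = index (proj₁ (remQuot {M} K x)) (proj₂ (remQuot {M} K x))

  Φ-combine : ∀ i j → Φ (vertex i j) ≡ index i j
  Φ-combine i j = cong (λ (c : Fin M × Fin K) → index (proj₁ c) (proj₂ c)) (remQuot-combine i j)

  Φ-injective : ∀ x y → Φ x ≡ Φ y → x ≡ y
  Φ-injective = by-coordinates {M} {K} _ λ i j → by-coordinates {M} {K} _ λ i′ j′ eq →
    index-injective i j i′ j′ (trans (sym (Φ-combine i j)) (trans eq (Φ-combine i′ j′)))

  f : Labeling X
  f = injective⇒permutation Φ Φ-injective

  ℓ : Fin M → Fin K → ℕ
  ℓ = labelAt (Cycle M) (Cycle K) f

  ℓ-value : ∀ i j → ℓ i j ≡ value (sign i j) (cell i j)
  ℓ-value i j = cong suc (trans (cong toℕ (Φ-combine i j)) (toℕ-cast _ _))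

  -- In the square around (i , j) the diagonals have equal cell sums and opposite signs,
  -- since i ± 1 and j ± 1 lie on opposite sides of their pairs.
  magic : ∀ x → weight X f x ≡ suc (h + h) + suc (h + h)
  magic = by-coordinates {M} {K} _ λ i j →
    let A = next i; a = prev i; B = next j; b = prev j; s = sign a b
        sA = side (toℕ a); sB = side (toℕ b) in begin
    weight X f (vertex i j)
      ≡⟨ weight-square {1 + p * 4} {1 + q * 4} f i j ⟩
    (ℓ A B + ℓ A b) + (ℓ a B + ℓ a b)
      ≡⟨ cong₂ _+_ (cong₂ _+_ (ℓ-value A B) (ℓ-value A b)) (cong₂ _+_ (ℓ-value a B) (ℓ-value a b)) ⟩
    (value (sign A B) (cell A B) + value (sign A b) (cell A b)) + (value (sign a B) (cell a B) + value s (cell a b))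
      ≡⟨ cong₂ (λ u v → (value u (cell A B) + value v (cell A b)) + (value (sign a B) (cell a B) + value s (cell a b)))
               (trans (cong₂ agree (side-next-prev p i) (side-next-prev q j)) (agree-not-not sA sB))
               (trans (cong (λ u → agree u (side (toℕ b))) (side-next-prev p i)) (agree-notˡ sA sB)) ⟩
    (value s (cell A B) + value (not s) (cell A b)) + (value (sign a B) (cell a B) + value s (cell a b))
      ≡⟨ cong (λ u → (value s (cell A B) + value (not s) (cell A b)) + (value u (cell a B) + value s (cell a b)))
              (trans (cong (agree sA) (side-next-prev q j)) (agree-notʳ sA sB)) ⟩
    (value s (cell A B) + value (not s) (cell A b)) + (value (not s) (cell a B) + value s (cell a b))
      ≡⟨ square-value s (cell A B) (cell A b) (cell a B) (cell a b) (diagonals A a B b) ⟩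
    suc (h + h) + suc (h + h) ∎
    where
    open ≡-Reasoning
    swap-ends : ∀ x y u v → (x + u) + (y + v) ≡ (x + v) + (y + u)
    swap-ends = solve-∀
    diagonals : ∀ A a B b → toℕ (cell A B) + toℕ (cell a b) ≡ toℕ (cell A b) + toℕ (cell a B)
    diagonals A a B b = begin
      toℕ (cell A B) + toℕ (cell a b)                              ≡⟨ cong₂ _+_ (toℕ-combine (pairOf A) B) (toℕ-combine (pairOf a) b) ⟩
      (K * toℕ (pairOf A) + toℕ B) + (K * toℕ (pairOf a) + toℕ b)  ≡⟨ swap-ends (K * toℕ (pairOf A)) (K * toℕ (pairOf a)) (toℕ B) (toℕ b) ⟩
      (K * toℕ (pairOf A) + toℕ b) + (K * toℕ (pairOf a) + toℕ B)  ≡⟨ cong₂ _+_ (toℕ-combine (pairOf A) b) (toℕ-combine (pairOf a) B) ⟨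
      toℕ (cell A b) + toℕ (cell a B)                              ∎

  distance-magic : IsDistanceMagic X
  distance-magic = f , suc (h + h) + suc (h + h) , s≤s z≤n , magic

multiple-of-4 : ∀ a → (3 + a) % 4 ≡ 0 → Σ ℕ λ p → 3 + a ≡ suc p * 4
multiple-of-4 a divisible with (3 + a) / 4 | m≡m%n+[m/n]*n (3 + a) 4
... | suc p | decomposition = p , trans decomposition (cong (_+ suc p * 4) divisible)
... | zero  | decomposition with () ← trans decomposition (cong (_+ 0) divisible)

balanced-characterisation : ∀ a b →
  IsBalancedDistanceMagic (Cycle (3 + a) ×ᵍ Cycle (3 + b)) ⇔ (3 + b ≡ 4 ⊎ 3 + a ≡ 4)
balanced-characterisation a b = mk⇔ necessary sufficient
  where
  necessary : IsBalancedDistanceMagic (Cycle (3 + a) ×ᵍ Cycle (3 + b)) → 3 + b ≡ 4 ⊎ 3 + a ≡ 4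
  necessary (_ , even , f , balanced) with 3 + b ≟ 4 | 3 + a ≟ 4
  ... | yes K≡4 | _       = inj₁ K≡4
  ... | no _    | yes M≡4 = inj₂ M≡4
  ... | no K≢4  | no M≢4  = ⊥-elim (no-balanced-labeling f even balanced M≢4 K≢4)
  sufficient : 3 + b ≡ 4 ⊎ 3 + a ≡ 4 → IsBalancedDistanceMagic (Cycle (3 + a) ×ᵍ Cycle (3 + b))
  sufficient (inj₁ refl) = balanced-invariant (×ᵍ-comm (Cycle (3 + a)) (Cycle 4)) (FourByK.balanced-distance-magic a)
  sufficient (inj₂ refl) = FourByK.balanced-distance-magic b

distance-magic-characterisation : ∀ a b →
  IsDistanceMagic (Cycle (3 + a) ×ᵍ Cycle (3 + b)) ⇔
    (3 + b ≡ 4 ⊎ 3 + a ≡ 4 ⊎ ((3 + a) % 4 ≡ 0 × (3 + b) % 4 ≡ 0))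
distance-magic-characterisation a b = mk⇔ necessary sufficient
  where
  necessary : IsDistanceMagic (Cycle (3 + a) ×ᵍ Cycle (3 + b)) →
    3 + b ≡ 4 ⊎ 3 + a ≡ 4 ⊎ ((3 + a) % 4 ≡ 0 × (3 + b) % 4 ≡ 0)
  necessary magic with (3 + a) % 4 ≟ 0 | (3 + b) % 4 ≟ 0
  ... | yes 4∣M | yes 4∣K = inj₂ (inj₂ (4∣M , 4∣K))
  ... | _       | no 4∤K  = inj₂ (inj₁ (distance-magic⇒length-4 magic 4∤K))
  ... | no 4∤M  | yes _   =
    inj₁ (distance-magic⇒length-4 (distance-magic-invariant (×ᵍ-comm (Cycle (3 + b)) (Cycle (3 + a))) magic) 4∤M)
  sufficient : 3 + b ≡ 4 ⊎ 3 + a ≡ 4 ⊎ ((3 + a) % 4 ≡ 0 × (3 + b) % 4 ≡ 0) →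
    IsDistanceMagic (Cycle (3 + a) ×ᵍ Cycle (3 + b))
  sufficient (inj₁ K≡4)        = proj₁ (Equivalence.from (balanced-characterisation a b) (inj₁ K≡4))
  sufficient (inj₂ (inj₁ M≡4)) = proj₁ (Equivalence.from (balanced-characterisation a b) (inj₂ M≡4))
  sufficient (inj₂ (inj₂ (4∣M , 4∣K)))
    with p , M≡4P ← multiple-of-4 a 4∣M | q , K≡4Q ← multiple-of-4 b 4∣K =
    subst₂ (λ M K → IsDistanceMagic (Cycle M ×ᵍ Cycle K)) (sym M≡4P) (sym K≡4Q) (MultiplesOf4.distance-magic p q)

theorem3p3 : (m n : ℕ) → m ≥ 3 → n ≥ 3 →
    (IsDistanceMagic (Cycle m ×ᵍ Cycle n) ⇔ (n ≡ 4 ⊎ m ≡ 4 ⊎ (m % 4 ≡ 0 × n % 4 ≡ 0)))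
    × (IsBalancedDistanceMagic (Cycle m ×ᵍ Cycle n) ⇔ (n ≡ 4 ⊎ m ≡ 4))
theorem3p3 (suc (suc (suc a))) (suc (suc (suc b))) _ _ =
  distance-magic-characterisation a b , balanced-characterisation a b
theorem3p3 0                   _ ()                  _
theorem3p3 1                   _ (s≤s ())            _
theorem3p3 2                   _ (s≤s (s≤s ()))      _
theorem3p3 (suc (suc (suc _))) 0 _ ()
theorem3p3 (suc (suc (suc _))) 1 _ (s≤s ())
theorem3p3 (suc (suc (suc _))) 2 _ (s≤s (s≤s ()))
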